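{- Let $n,k\in\mathbb N$ with $k\ge2$, and let $b=n^k+1$. Then for every $m\in\{2,3,\dots,n\}$, the number $(m\cdot n)^k$ is antipalindromic in base $b$.
   Context: For $b\in\mathbb N$, $b\ge2$, write a natural number $x$ in base $b$ as $x=a_tb^t+\dots+a_1b+a_0$ with digits $a_i\in\{0,1,\dots,b-1\}$ and $a_t\neq 0$. The number $x$ is called antipalindromic in base $b$ if $a_j=b-1-a_{t-j}$ for all $j\in\{0,1,\dots,t\}$. -}

module Defs where

open import Data.Nat using (ℕ; zero; suc; _+_; _*_; _∸_; _<_)
open import Data.List using (List; []; _∷_; map; reverse; last)
open import Data.List.Relation.Unary.All using (All)
open import Data.Maybe using (Maybe; just)
open import Data.Product using (∃; _×_)
open import Relation.Binary.PropositionalEquality using (_≡_; _≢_)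

evalDigits : ℕ → List ℕ → ℕ
evalDigits b []       = 0
evalDigits b (a ∷ as) = a + b * evalDigits b as

IsBaseExpansion : ℕ → ℕ → List ℕ → Set
IsBaseExpansion b x ds =
  All (λ a → a < b) ds × (∃ λ a → last ds ≡ just a × a ≢ 0) × evalDigits b ds ≡ x

-- x antipalindromic in base b: its expansion a₀…a_t satisfies a_j = b-1-a_{t-j}
-- for all j, i.e. the reversed digit list equals the list of (b-1-a_j).
Antipalindromic : ℕ → ℕ → Set
Antipalindromic b x =
  ∃ λ ds → IsBaseExpansion b x ds × reverse ds ≡ map (λ a → (b ∸ 1) ∸ a) ds

-- Put N = n ^ k and c = m ^ k, so that (m n) ^ k = c N with 2 ≤ c ≤ N. Then
-- c N = (N + 1 − c) + (N + 1)(c − 1): its base-(N + 1) digits are N + 1 − c and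
-- c − 1 ≠ 0, and any two-digit number whose digits sum to the largest digit N
-- is antipalindromic.
module Submission where

open import Defs
open import Data.Nat using (ℕ; zero; suc; _+_; _*_; _^_; _≤_; _∸_; z≤n; s≤s)
open import Data.Nat.Properties
open import Data.Nat.Tactic.RingSolver using (solve-∀)
open import Data.List using ([]; _∷_)
open import Data.List.Relation.Unary.All using ([]; _∷_)
open import Data.Product using (_,_)
open import Relation.Binary.PropositionalEquality

^-distribʳ-* : ∀ m n k → (m * n) ^ k ≡ m ^ k * n ^ k
^-distribʳ-* m n zero    = refl
^-distribʳ-* m n (suc k) = begin
  m * n * (m * n) ^ k    ≡⟨ cong (m * n *_) (^-distribʳ-* m n k) ⟩
  m * n * (m ^ k * n ^ k) ≡⟨ interchange m n (m ^ k) (n ^ k) ⟩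
  m * m ^ k * (n * n ^ k) ∎
  where
  open ≡-Reasoning
  interchange : ∀ a b c d → a * b * (c * d) ≡ a * c * (b * d)
  interchange = solve-∀

m≤m^[1+k] : ∀ m k → m ≤ m ^ suc k
m≤m^[1+k] zero    k = z≤n
m≤m^[1+k] (suc m) k = subst (_≤ suc m ^ suc k) (*-identityʳ (suc m))
                            (^-monoʳ-≤ (suc m) {1} {suc k} (s≤s z≤n))

antipalindromic-twoDigits : ∀ a₀ a₁ → a₁ ≢ 0 →
  Antipalindromic (suc (a₀ + a₁)) (a₀ + suc (a₀ + a₁) * a₁)
antipalindromic-twoDigits a₀ a₁ a₁≢0 =
  (a₀ ∷ a₁ ∷ []) ,
  ( (s≤s (m≤m+n a₀ a₁) ∷ s≤s (m≤n+m a₁ a₀) ∷ [])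
  , (a₁ , refl , a₁≢0)
  , cong (λ x → a₀ + b * x) (trans (cong (a₁ +_) (*-zeroʳ b)) (+-identityʳ a₁)) ) ,
  cong₂ (λ x y → x ∷ y ∷ []) (sym (m+n∸m≡n a₀ a₁)) (sym (m+n∸n≡m a₀ a₁))
  where
  b : ℕ
  b = suc (a₀ + a₁)

antipalindromic-*-base-pred : ∀ {c N} → 2 ≤ c → c ≤ N → Antipalindromic (N + 1) (c * N)
antipalindromic-*-base-pred {suc a₁} {N} (s≤s 1≤a₁) c≤N =
  subst (λ M → Antipalindromic (M + 1) (suc a₁ * M)) (m∸n+n≡m a₁≤N)
    (subst₂ Antipalindromic (+-comm 1 (a₀ + a₁)) (twoDigit-value a₀ a₁)
      (antipalindromic-twoDigits a₀ a₁ (≢-sym (<⇒≢ 1≤a₁))))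
  where
  a₁≤N : a₁ ≤ N
  a₁≤N = ≤-trans (n≤1+n a₁) c≤N
  a₀ : ℕ
  a₀ = N ∸ a₁
  twoDigit-value : ∀ a₀ a₁ → a₀ + suc (a₀ + a₁) * a₁ ≡ suc a₁ * (a₀ + a₁)
  twoDigit-value = solve-∀

mainTheorem11 : (n k : ℕ) → 2 ≤ k → (m : ℕ) → 2 ≤ m → m ≤ n →
    Antipalindromic (n ^ k + 1) ((m * n) ^ k)
mainTheorem11 n (suc k) _ m 2≤m m≤n =
  subst (Antipalindromic (n ^ suc k + 1)) (sym (^-distribʳ-* m n (suc k)))
    (antipalindromic-*-base-pred (≤-trans 2≤m (m≤m^[1+k] m k)) (^-monoˡ-≤ (suc k) m≤n))
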